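{- Let $n\ge 3$. If $\pi_1,\pi_2\in S_n$ have the same number of fixed points, then $G^-_{\pi_1}\approx G^-_{\pi_2}$.
   Context: $S_n$ is the symmetric group on $\{1,\dots,n\}$; a fixed point of $\pi$ is $i$ with $\pi(i)=i$. Fix disjoint vertex sets $A=\{a_1,\dots,a_n\}$, $B=\{b_1,\dots,b_n\}$, $C=\{c_1,\dots,c_n\}$, $D=\{d_1,\dots,d_n\}$. For $\pi\in S_n$, $G^-_\pi$ is the graph on $A\cup B\cup C\cup D$ with edges $\{a_i,b_j\}$ ($i\ne j$), $\{b_i,c_i\}$ (all $i$), $\{c_i,d_j\}$ ($i\ne j$), and $\{a_i,d_{\pi(i)}\}$ (all $i$); it is a connected bipartite graph with parts $A\cup C$ and $B\cup D$. For a vertex set $S$, $N(S)$ is the set of vertices adjacent to some vertex of $S$. Two connected bipartite graphs $G,H$ are neighbourhood size equivalent, $G\approx H$, if there are bipartitions $(X^G,Y^G)$ of $G$ and $(X^H,Y^H)$ of $H$ with $|X^G|\le|Y^G|$, $|X^H|\le|Y^H|$, $|X^G|=|X^H|$, $|Y^G|=|Y^H|$, and a bijection $\eta$ from the power set of $X^G$ to the power set of $X^H$ such that for every $S\subseteq X^G$: $|\eta(S)|=|S|$ and $|N(\eta(S))| = |N(S)|$. -}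

module Defs where

open import Data.Nat using (ℕ; _*_; _≤_)
open import Data.Bool using (Bool; true; false; not; _∨_; _∧_)
open import Data.Fin using (Fin; zero; suc; remQuot; _≟_)
open import Data.Fin.Subset using (Subset; _∈_; _⊆_; ∁; ∣_∣)
open import Data.Fin.Permutation using (Permutation′; _⟨$⟩ʳ_)
open import Data.Vec using (tabulate)
open import Data.Product using (Σ; _×_; _,_; ∃)
open import Data.Sum using (_⊎_)
open import Relation.Nullary.Decidable using (⌊_⌋)
open import Relation.Binary.PropositionalEquality using (_≡_)

Graph : ℕ → Set
Graph V = Fin V → Fin V → Bool

anyFin : ∀ {V} → (Fin V → Bool) → Bool
anyFin {ℕ.zero}  f = false
anyFin {ℕ.suc V} f = f zero ∨ anyFin (λ i → f (suc i))

N : ∀ {V} → Graph V → Subset V → Subset V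
N G S = tabulate (λ v → anyFin (λ u → Data.Vec.lookup S u ∧ G u v))
  where import Data.Vec

IsBipartition : ∀ {V} → Graph V → Subset V → Subset V → Set
IsBipartition {V} G X Y =
  (Y ≡ ∁ X) ×
  (∀ (u v : Fin V) → G u v ≡ true → (u ∈ X × v ∈ Y) ⊎ (u ∈ Y × v ∈ X))

-- Neighbourhood size equivalence G ≈ H.
-- η is a bijection from the power set of X^G to the power set of X^H,
-- spelled out: a map on subsets sending subsets of X^G to subsets of X^H,
-- injective on subsets of X^G, and hitting every subset of X^H.
NSEquiv : ∀ {V W} → Graph V → Graph W → Set
NSEquiv {V} {W} G H =
  Σ (Subset V) λ XG → Σ (Subset V) λ YG →
  Σ (Subset W) λ XH → Σ (Subset W) λ YH →
  IsBipartition G XG YG × IsBipartition H XH YH ×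
  ∣ XG ∣ ≤ ∣ YG ∣ × ∣ XH ∣ ≤ ∣ YH ∣ ×
  ∣ XG ∣ ≡ ∣ XH ∣ × ∣ YG ∣ ≡ ∣ YH ∣ ×
  Σ (Subset V → Subset W) λ η →
    (∀ S → S ⊆ XG → η S ⊆ XH) ×
    (∀ S T → S ⊆ XG → T ⊆ XG → η S ≡ η T → S ≡ T) ×
    (∀ T → T ⊆ XH → ∃ λ S → S ⊆ XG × η S ≡ T) ×
    (∀ S → S ⊆ XG → ∣ η S ∣ ≡ ∣ S ∣ × ∣ N H (η S) ∣ ≡ ∣ N G S ∣)

-- The graph G^-_π.  Vertex (k , i) with k : Fin 4, i : Fin n is encoded as
-- Data.Fin.combine k i : Fin (4 * n); k = 0,1,2,3 stands for a_i, b_i, c_i, d_i.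

neq : ∀ {n} → Fin n → Fin n → Bool
neq i j = not ⌊ i ≟ j ⌋

eqb : ∀ {n} → Fin n → Fin n → Bool
eqb i j = ⌊ i ≟ j ⌋

adjLab : ∀ {n} → Permutation′ n → Fin 4 × Fin n → Fin 4 × Fin n → Bool
adjLab π (zero , i) (suc zero , j) = neq i j
adjLab π (suc zero , j) (zero , i) = neq i j
adjLab π (suc zero , i) (suc (suc zero) , j) = eqb i j
adjLab π (suc (suc zero) , j) (suc zero , i) = eqb i j
adjLab π (suc (suc zero) , i) (suc (suc (suc zero)) , j) = neq i j
adjLab π (suc (suc (suc zero)) , j) (suc (suc zero) , i) = neq i j
adjLab π (zero , i) (suc (suc (suc zero)) , j) = eqb (π ⟨$⟩ʳ i) j
adjLab π (suc (suc (suc zero)) , j) (zero , i) = eqb (π ⟨$⟩ʳ i) j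
adjLab π _ _ = false

Gminus : ∀ n → Permutation′ n → Graph (4 * n)
Gminus n π u v = adjLab π (remQuot n u) (remQuot n v)

fixCount : ∀ {n} → Permutation′ n → ℕ
fixCount {n} π = ∣ tabulate (λ i → eqb (π ⟨$⟩ʳ i) i) ∣

{-# OPTIONS --safe #-}
-- Split a subset S of X = A ∪ C into I = {x ∣ a_x ∈ S} and J = {x ∣ c_x ∈ S}. Then
--   b_y ∈ N(S)  iff  I ∖ {y} ≠ ∅  or  y ∈ J,
--   d_y ∈ N(S)  iff  y ∈ π(I)     or  J ∖ {y} ≠ ∅.
-- Equal numbers of fixed points give a permutation Λ with Λ(Fix π₁) = Fix π₂, so for every j the
-- assignment j ↦ Λ j, π₁⁻¹ j ↦ π₂⁻¹ (Λ j) is a well-defined injection; extend it to a permutation ρ_j.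
-- Put r = ρ_j if J = {j} and r = Λ otherwise, and η(I , J) = (r I , Λ J). Since r depends on J
-- alone, η is a size-preserving bijection on subsets of X. Renaming b_y to b_{r y} and d_y to
-- d_{π₂ (r (π₁⁻¹ y))} carries N(S) onto N(η S): the conditions on I transfer verbatim, those on J
-- hold by the choice of ρ_j when J is a singleton, and otherwise "J ∖ {y} ≠ ∅" just says J ≠ ∅.
module Submission where

open import Defs
open import Data.Nat using (ℕ; zero; suc; _+_; _*_; _≤_)
open import Data.Nat.Properties using (+-0-commutativeMonoid; 1+n≰n; suc-injective; ≤-reflexive)
open import Data.Bool using (Bool; true; false; not; _∧_; _∨_; T; if_then_else_)
import Data.Bool as Bool
open import Data.Bool.Properties using (T-≡; T-∧; T-∨; ∨-assoc; ∨-identityʳ; ∧-comm; ¬-not)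
open import Data.Fin using (Fin; zero; suc; _≟_; combine; remQuot; quotient; _↑ˡ_; _↑ʳ_)
open import Data.Fin.Properties using (any?; *↔×; remQuot-combine; combine-remQuot)
open import Data.Fin.Permutation
  using (Permutation′; _⟨$⟩ʳ_; _⟨$⟩ˡ_; inverseˡ; inverseʳ; flip; _∘ₚ_; lift₀; transpose)
import Data.Fin.Permutation as Perm
import Data.Fin.Permutation.Components as PC
open import Data.Fin.Subset using (Subset; ∣_∣; _∈_; _⊆_; ∁; ⁅_⁆)
open import Data.Fin.Subset.Properties using (∣p∣≤n; x∈⁅y⁆⇔x≡y; x∈p⇒x∉∁p; x∉p⇒x∈∁p; x∈∁p⇒x∉p)
open import Data.Vec using (tabulate; lookup; _∷_)
open import Data.Vec.Properties
  using (tabulate-cong; tabulate∘lookup; lookup∘tabulate; lookup-map; lookup⇒[]=; []=⇒lookup; ≡-dec)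
open import Data.Product using (∃; _×_; _,_; proj₁; proj₂)
open import Data.Product.Function.Dependent.Propositional using (Σ-↔)
open import Data.Sum using (_⊎_; inj₁; inj₂)
open import Function using (_∘_; _⇔_; mk⇔; Equivalence; Injection)
open import Function.Properties.Inverse using (↔⇒↣)
open import Function.Construct.Composition using (_↔-∘_; _⇔-∘_)
open import Function.Construct.Symmetry using (↔-sym; ⇔-sym)
open import Relation.Nullary using (Dec; yes; no; ¬_; contradiction)
open import Relation.Nullary.Decidable
  using (T?; does-⇔; isYes≗does; toWitness; fromWitness; dec-true; dec-false; decidable-stable; _×-dec_; ¬?)
open import Relation.Binary.PropositionalEquality
  using (_≡_; _≢_; refl; sym; trans; cong; cong₂; subst; module ≡-Reasoning)
open import Algebra.Properties.CommutativeMonoid.Sum +-0-commutativeMonoid using (sum; sum-permute)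

open Equivalence using (to; from)

private
  variable
    m n : ℕ

T-injective : ∀ {a b} → (T a ⇔ T b) → a ≡ b
T-injective {a} {b} a⇔b = does-⇔ a⇔b (T? a) (T? b)

T-eqb : {i j : Fin n} → T (eqb i j) ⇔ i ≡ j
T-eqb = mk⇔ toWitness fromWitness

T-neq : {i j : Fin n} → T (neq i j) ⇔ (i ≢ j)
T-neq {i = i} {j} with i ≟ j
... | yes i≡j = mk⇔ (λ ()) (λ i≢j → i≢j i≡j)
... | no  i≢j = mk⇔ (λ _ → i≢j) _

⇔⇒eqb-≡ : {i j k l : Fin n} → (i ≡ j ⇔ k ≡ l) → eqb i j ≡ eqb k l
⇔⇒eqb-≡ {i = i} {j} {k} {l} h =
  trans (isYes≗does (i ≟ j)) (trans (does-⇔ h (i ≟ j) (k ≟ l)) (sym (isYes≗does (k ≟ l))))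

eqb-≡⇒⇔ : {i j k l : Fin n} → eqb i j ≡ eqb k l → (i ≡ j ⇔ k ≡ l)
eqb-≡⇒⇔ e = mk⇔ (λ i≡j → to T-eqb (subst T e (from T-eqb i≡j)))
                (λ k≡l → to T-eqb (subst T (sym e) (from T-eqb k≡l)))

eqb-permute : (π : Permutation′ n) (i j : Fin n) → eqb (π ⟨$⟩ʳ i) (π ⟨$⟩ʳ j) ≡ eqb i j
eqb-permute π i j = ⇔⇒eqb-≡ (mk⇔ (Injection.injective (↔⇒↣ π)) (cong (π ⟨$⟩ʳ_)))

anyFin⁺ : {f : Fin n → Bool} (i : Fin n) → T (f i) → T (anyFin f)
anyFin⁺ zero    fi = from T-∨ (inj₁ fi)
anyFin⁺ (suc i) fi = from T-∨ (inj₂ (anyFin⁺ i fi))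

anyFin⁻ : (f : Fin n → Bool) → T (anyFin f) → ∃ λ i → T (f i)
anyFin⁻ {suc n} f h with to T-∨ h
... | inj₁ f0   = zero , f0
... | inj₂ rest = let (i , fi) = anyFin⁻ (f ∘ suc) rest in suc i , fi

anyFin-cong : {f g : Fin n → Bool} → (∀ i → f i ≡ g i) → anyFin f ≡ anyFin g
anyFin-cong {zero}  f≗g = refl
anyFin-cong {suc n} f≗g = cong₂ _∨_ (f≗g zero) (anyFin-cong (f≗g ∘ suc))

anyFin-permute : (π : Permutation′ n) (f : Fin n → Bool) → anyFin (f ∘ (π ⟨$⟩ʳ_)) ≡ anyFin f
anyFin-permute π f = T-injective (mk⇔
  (λ h → let (i , fπi) = anyFin⁻ (f ∘ (π ⟨$⟩ʳ_)) h in anyFin⁺ (π ⟨$⟩ʳ i) fπi)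
  (λ h → let (i , fi) = anyFin⁻ f h in anyFin⁺ (π ⟨$⟩ˡ i) (subst (T ∘ f) (sym (inverseʳ π)) fi)))

anyFin-relabel : (π : Permutation′ n) (f g : Fin n → Bool) →
  anyFin (λ x → f (π ⟨$⟩ˡ x) ∧ g x) ≡ anyFin (λ x → f x ∧ g (π ⟨$⟩ʳ x))
anyFin-relabel π f g = trans (sym (anyFin-permute π (λ x → f (π ⟨$⟩ˡ x) ∧ g x)))
  (anyFin-cong (λ x → cong (λ y → f y ∧ g (π ⟨$⟩ʳ x)) (inverseˡ π)))

anyFin-∧-false : (f : Fin n → Bool) → anyFin (λ x → f x ∧ false) ≡ false
anyFin-∧-false f = T-injective (mk⇔
  (λ h → let (_ , fx∧false) = anyFin⁻ (λ x → f x ∧ false) h in proj₂ (to T-∧ fx∧false))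
  (λ ()))

anyFin-∧-eqb : (f : Fin n → Bool) (y : Fin n) → anyFin (λ x → f x ∧ eqb y x) ≡ f y
anyFin-∧-eqb f y = T-injective (mk⇔
  (λ h → let (x , fx∧y≡x) = anyFin⁻ (λ x → f x ∧ eqb y x) h ; (fx , y≡x) = to T-∧ fx∧y≡x
         in subst (T ∘ f) (sym (to T-eqb y≡x)) fx)
  (λ fy → anyFin⁺ y (from T-∧ (fy , from T-eqb refl))))

anyFin-↑ : (f : Fin (m + n) → Bool) → anyFin f ≡ anyFin (f ∘ (_↑ˡ n)) ∨ anyFin (f ∘ (m ↑ʳ_))
anyFin-↑ {zero}      f = refl
anyFin-↑ {suc m} {n} f =
  trans (cong (f zero ∨_) (anyFin-↑ {m} {n} (f ∘ suc))) (sym (∨-assoc (f zero) _ _))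

anyFin-combine : (f : Fin (m * n) → Bool) →
  anyFin f ≡ anyFin (λ (k : Fin m) → anyFin (λ (x : Fin n) → f (combine k x)))
anyFin-combine {zero}      f = refl
anyFin-combine {suc m} {n} f = trans (anyFin-↑ {n} {m * n} f)
  (cong (anyFin (λ x → f (x ↑ˡ m * n)) ∨_) (anyFin-combine {m} (f ∘ (n ↑ʳ_))))

∣tabulate∣≡sum : (f : Fin n → Bool) → ∣ tabulate f ∣ ≡ sum (λ i → if f i then 1 else 0)
∣tabulate∣≡sum {zero}  f = refl
∣tabulate∣≡sum {suc n} f with f zero
... | true  = cong suc (∣tabulate∣≡sum (f ∘ suc))
... | false = ∣tabulate∣≡sum (f ∘ suc)

∣tabulate∣-permute : (π : Permutation′ n) (f : Fin n → Bool) →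
  ∣ tabulate (f ∘ (π ⟨$⟩ʳ_)) ∣ ≡ ∣ tabulate f ∣
∣tabulate∣-permute π f = begin
  ∣ tabulate (f ∘ (π ⟨$⟩ʳ_)) ∣              ≡⟨ ∣tabulate∣≡sum (f ∘ (π ⟨$⟩ʳ_)) ⟩
  sum (λ i → if f (π ⟨$⟩ʳ i) then 1 else 0) ≡⟨ sum-permute (λ i → if f i then 1 else 0) π ⟨
  sum (λ i → if f i then 1 else 0)          ≡⟨ ∣tabulate∣≡sum f ⟨
  ∣ tabulate f ∣                            ∎
  where open ≡-Reasoning

∣∣-permute : (π : Permutation′ n) {S S′ : Subset n} →
  (∀ i → lookup S (π ⟨$⟩ʳ i) ≡ lookup S′ i) → ∣ S ∣ ≡ ∣ S′ ∣
∣∣-permute π {S} {S′} Sπ≗S′ = begin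
  ∣ S ∣                                ≡⟨ cong ∣_∣ (tabulate∘lookup S) ⟨
  ∣ tabulate (lookup S) ∣              ≡⟨ ∣tabulate∣-permute π (lookup S) ⟨
  ∣ tabulate (lookup S ∘ (π ⟨$⟩ʳ_)) ∣  ≡⟨ cong ∣_∣ (tabulate-cong Sπ≗S′) ⟩
  ∣ tabulate (lookup S′) ∣             ≡⟨ cong ∣_∣ (tabulate∘lookup S′) ⟩
  ∣ S′ ∣                               ∎
  where open ≡-Reasoning

∣∷∣-cancel : ∀ b {v w : Subset n} → ∣ b ∷ v ∣ ≡ ∣ b ∷ w ∣ → ∣ v ∣ ≡ ∣ w ∣
∣∷∣-cancel true  = suc-injective
∣∷∣-cancel false = λ h → h

∣tabulate-const∣ : ∀ n b → ∣ tabulate {n} (λ _ → b) ∣ ≡ (if b then n else 0)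
∣tabulate-const∣ zero    true  = refl
∣tabulate-const∣ zero    false = refl
∣tabulate-const∣ (suc n) true  = cong suc (∣tabulate-const∣ n true)
∣tabulate-const∣ (suc n) false = ∣tabulate-const∣ n false

∃-preimage : (P Q : Fin (suc n) → Bool) → ∣ tabulate P ∣ ≡ ∣ tabulate Q ∣ → ∃ λ j → Q j ≡ P zero
∃-preimage {n} P Q ∣P∣≡∣Q∣ with any? (λ j → Q j Bool.≟ P zero)
... | yes found = found
... | no  none  = contradiction
  (trans ∣P∣≡∣Q∣ (cong ∣_∣ (tabulate-cong (λ j → ¬-not (none ∘ (j ,_))))))
  (differs (P zero) (tabulate (P ∘ suc)))
  where
  differs : ∀ b (v : Subset n) → ∣ b ∷ v ∣ ≢ ∣ tabulate {suc n} (λ _ → not b) ∣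
  differs true  v h with () ← trans h (∣tabulate-const∣ (suc n) false)
  differs false v h = 1+n≰n (subst (_≤ n) (trans h (∣tabulate-const∣ (suc n) true)) (∣p∣≤n v))

transpose-matchˡ : (i j : Fin n) → PC.transpose i j i ≡ j
transpose-matchˡ i j rewrite dec-true (i ≟ i) refl = refl

transpose-other : {i j k : Fin n} → k ≢ i → k ≢ j → PC.transpose i j k ≡ k
transpose-other {i = i} {j} {k} k≢i k≢j rewrite dec-false (k ≟ i) k≢i | dec-false (k ≟ j) k≢j = refl

align : (P Q : Fin n → Bool) → ∣ tabulate P ∣ ≡ ∣ tabulate Q ∣ →
  ∃ λ (σ : Permutation′ n) → ∀ k → Q (σ ⟨$⟩ʳ k) ≡ P k
align {zero}  P Q _ = Perm.id , λ ()
align {suc n} P Q ∣P∣≡∣Q∣ = lift₀ σ ∘ₚ τ , aligned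
  where
  j : Fin (suc n)
  j = proj₁ (∃-preimage P Q ∣P∣≡∣Q∣)
  τ : Permutation′ (suc n)
  τ = transpose zero j
  Qτ : Fin (suc n) → Bool
  Qτ = Q ∘ (τ ⟨$⟩ʳ_)
  Qτ-head : Qτ zero ≡ P zero
  Qτ-head = trans (cong Q (transpose-matchˡ zero j)) (proj₂ (∃-preimage P Q ∣P∣≡∣Q∣))
  tails : ∣ tabulate (P ∘ suc) ∣ ≡ ∣ tabulate (Qτ ∘ suc) ∣
  tails = ∣∷∣-cancel (P zero) {tabulate (P ∘ suc)} {tabulate (Qτ ∘ suc)}
    (trans ∣P∣≡∣Q∣ (trans (sym (∣tabulate∣-permute τ Q))
                          (cong (λ b → ∣ b ∷ tabulate (Qτ ∘ suc) ∣) Qτ-head)))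
  σ : Permutation′ n
  σ = proj₁ (align (P ∘ suc) (Qτ ∘ suc) tails)
  aligned : ∀ k → Q (τ ⟨$⟩ʳ (lift₀ σ ⟨$⟩ʳ k)) ≡ P k
  aligned zero    = Qτ-head
  aligned (suc k) = proj₂ (align (P ∘ suc) (Qτ ∘ suc) tails) k

pair-permutation : (a b c d : Fin n) → (a ≡ b ⇔ c ≡ d) →
  ∃ λ (ρ : Permutation′ n) → ρ ⟨$⟩ʳ a ≡ c × ρ ⟨$⟩ʳ b ≡ d
pair-permutation {n} a b c d a≡b⇔c≡d = transpose a c ∘ₚ transpose b′ d , ρa≡c , transpose-matchˡ b′ d
  where
  b′ : Fin n
  b′ = PC.transpose a c b
  ρa≡c : PC.transpose b′ d (PC.transpose a c a) ≡ c
  ρa≡c with a ≟ b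
  ... | yes refl rewrite transpose-matchˡ a c =
    trans (transpose-matchˡ c d) (sym (to a≡b⇔c≡d refl))
  ... | no a≢b rewrite transpose-matchˡ a c = transpose-other
    (λ c≡b′ → a≢b (trans (sym (transpose-matchˡ c a))
                         (trans (cong (PC.transpose c a) c≡b′) (PC.transpose-inverse c a))))
    (a≢b ∘ from a≡b⇔c≡d)

fixed-flip : (π : Permutation′ n) {x : Fin n} → π ⟨$⟩ʳ x ≡ x ⇔ x ≡ π ⟨$⟩ˡ x
fixed-flip π = mk⇔ (λ e → trans (sym (inverseˡ π)) (cong (π ⟨$⟩ˡ_) e))
                   (λ e → trans (cong (π ⟨$⟩ʳ_) e) (inverseʳ π))

combine-ind : {P : Fin (m * n) → Set} → (∀ k x → P (combine k x)) → ∀ v → P v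
combine-ind {m} {n} {P} p v =
  subst P (combine-remQuot {m} n v) (p (proj₁ (remQuot {m} n v)) (proj₂ (remQuot {m} n v)))

blockwise : Permutation′ m → (Fin m → Permutation′ n) → Permutation′ (m * n)
blockwise L φ = ↔-sym *↔× ↔-∘ (Σ-↔ L (λ {k} → φ k) ↔-∘ *↔×)

blockwise-combine : (L : Permutation′ m) (φ : Fin m → Permutation′ n) (k : Fin m) (x : Fin n) →
  blockwise L φ ⟨$⟩ʳ combine k x ≡ combine (L ⟨$⟩ʳ k) (φ k ⟨$⟩ʳ x)
blockwise-combine {m} {n} L φ k x =
  cong (λ (k′ , x′) → combine (L ⟨$⟩ʳ k′) (φ k′ ⟨$⟩ʳ x′)) (remQuot-combine {m} {n} k x)

∣∣-blockwise : (L : Permutation′ m) (φ : Fin m → Permutation′ n) {S S′ : Subset (m * n)} →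
  (∀ k x → lookup S (combine (L ⟨$⟩ʳ k) (φ k ⟨$⟩ʳ x)) ≡ lookup S′ (combine k x)) → ∣ S ∣ ≡ ∣ S′ ∣
∣∣-blockwise L φ {S} {S′} h = ∣∣-permute (blockwise L φ) {S} {S′} (combine-ind λ k x →
  trans (cong (lookup S) (blockwise-combine L φ k x)) (h k x))

fibrewise : (Fin m → Permutation′ n) → Permutation′ (m * n)
fibrewise = blockwise Perm.id

fibrewise-combine⁻¹ : (φ : Fin m → Permutation′ n) (k : Fin m) (x : Fin n) →
  fibrewise φ ⟨$⟩ˡ combine k x ≡ combine k (φ k ⟨$⟩ˡ x)
fibrewise-combine⁻¹ φ k x = begin
  fibrewise φ ⟨$⟩ˡ combine k x
    ≡⟨ cong (λ y → fibrewise φ ⟨$⟩ˡ combine k y) (inverseʳ (φ k)) ⟨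
  fibrewise φ ⟨$⟩ˡ combine k (φ k ⟨$⟩ʳ (φ k ⟨$⟩ˡ x))
    ≡⟨ cong (fibrewise φ ⟨$⟩ˡ_) (blockwise-combine Perm.id φ k (φ k ⟨$⟩ˡ x)) ⟨
  fibrewise φ ⟨$⟩ˡ (fibrewise φ ⟨$⟩ʳ combine k (φ k ⟨$⟩ˡ x))
    ≡⟨ inverseˡ (fibrewise φ) ⟩
  combine k (φ k ⟨$⟩ˡ x) ∎
  where open ≡-Reasoning

relabel : Permutation′ n → Subset n → Subset n
relabel β S = tabulate (λ v → lookup S (β ⟨$⟩ˡ v))

∣relabel∣ : (β : Permutation′ n) (S : Subset n) → ∣ relabel β S ∣ ≡ ∣ S ∣
∣relabel∣ β S = ∣∣-permute β {relabel β S} {S} λ v →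
  trans (lookup∘tabulate _ (β ⟨$⟩ʳ v)) (cong (lookup S) (inverseˡ β))

relabel-flip : (β : Permutation′ n) (S : Subset n) → relabel (flip β) (relabel β S) ≡ S
relabel-flip β S = trans
  (tabulate-cong λ v → trans (lookup∘tabulate _ (β ⟨$⟩ʳ v)) (cong (lookup S) (inverseˡ β)))
  (tabulate∘lookup S)

lookup-relabel-fibrewise : (φ : Fin m → Permutation′ n) (S : Subset (m * n)) (k : Fin m) (x : Fin n) →
  lookup (relabel (fibrewise φ) S) (combine k x) ≡ lookup S (combine k (φ k ⟨$⟩ˡ x))
lookup-relabel-fibrewise φ S k x =
  trans (lookup∘tabulate _ (combine k x)) (cong (lookup S) (fibrewise-combine⁻¹ φ k x))

lookup-relabel-fibrewise⁻¹ : (φ : Fin m → Permutation′ n) (S : Subset (m * n)) (k : Fin m) (x : Fin n) →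
  lookup (relabel (flip (fibrewise φ)) S) (combine k x) ≡ lookup S (combine k (φ k ⟨$⟩ʳ x))
lookup-relabel-fibrewise⁻¹ φ S k x =
  trans (lookup∘tabulate _ (combine k x)) (cong (lookup S) (blockwise-combine Perm.id φ k x))

∈⇔T-lookup : {S : Subset n} {v : Fin n} → v ∈ S ⇔ T (lookup S v)
∈⇔T-lookup {S = S} {v} = mk⇔ (from T-≡ ∘ []=⇒lookup) (lookup⇒[]= v S ∘ to T-≡)

∈-tabulate : {f : Fin n → Bool} {v : Fin n} → v ∈ tabulate f ⇔ T (f v)
∈-tabulate {f = f} {v} = subst (λ b → v ∈ tabulate f ⇔ T b) (lookup∘tabulate f v) ∈⇔T-lookup

Singleton : Subset n → Set
Singleton J = ∃ λ j → J ≡ ⁅ j ⁆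

singleton? : (J : Subset n) → Dec (Singleton J)
singleton? J = any? (λ j → ≡-dec Bool._≟_ J ⁅ j ⁆)

T-⁅⁆ : {i j : Fin n} → T (lookup ⁅ j ⁆ i) ⇔ i ≡ j
T-⁅⁆ = x∈⁅y⁆⇔x≡y ⇔-∘ ⇔-sym ∈⇔T-lookup

lookup-⁅⁆ : {i j : Fin n} → lookup ⁅ j ⁆ i ≡ eqb j i
lookup-⁅⁆ = T-injective (mk⇔ (λ h → from T-eqb (sym (to T-⁅⁆ h))) (λ h → from T-⁅⁆ (sym (to T-eqb h))))

singleton-eqb : {f : Fin n → Bool} {j : Fin n} → tabulate f ≡ ⁅ j ⁆ → ∀ x → f x ≡ eqb j x
singleton-eqb {f = f} f≡⁅j⁆ x =
  trans (sym (lookup∘tabulate f x)) (trans (cong (λ J → lookup J x) f≡⁅j⁆) lookup-⁅⁆)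

anyFin-singleton : {f : Fin n → Bool} {j : Fin n} → tabulate f ≡ ⁅ j ⁆ → (g : Fin n → Bool) →
  anyFin (λ x → f x ∧ g x) ≡ g j
anyFin-singleton {f = f} {j} f≡⁅j⁆ g = trans
  (anyFin-cong λ x → trans (cong (_∧ g x) (singleton-eqb f≡⁅j⁆ x)) (∧-comm (eqb j x) (g x)))
  (anyFin-∧-eqb g j)

another-element : {f : Fin n → Bool} {x : Fin n} → ¬ Singleton (tabulate f) → T (f x) →
  ∃ λ x′ → T (f x′) × x′ ≢ x
another-element {f = f} {x} ¬single fx with any? (λ x′ → T? (f x′) ×-dec ¬? (x′ ≟ x))
... | yes found = found
... | no  none  = contradiction (x , f≡⁅x⁆) ¬single
  where
  f≡⁅x⁆ : tabulate f ≡ ⁅ x ⁆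
  f≡⁅x⁆ = trans (tabulate-cong λ x′ → T-injective (mk⇔
      (λ fx′ → from T-⁅⁆ (decidable-stable (x′ ≟ x) (λ x′≢x → none (x′ , fx′ , x′≢x))))
      (λ x′≡x → subst (T ∘ f) (sym (to T-⁅⁆ x′≡x)) fx)))
    (tabulate∘lookup ⁅ x ⁆)

nonSingleton-avoids : {f : Fin n → Bool} → ¬ Singleton (tabulate f) → (π : Permutation′ n) (w : Fin n) →
  ∃ (T ∘ f) → T (anyFin (λ x → f x ∧ neq (π ⟨$⟩ʳ x) w))
nonSingleton-avoids ¬single π w (x , fx) with π ⟨$⟩ʳ x ≟ w
... | no  πx≢w = anyFin⁺ x (from T-∧ (fx , from T-neq πx≢w))
... | yes πx≡w = let (x′ , fx′ , x′≢x) = another-element ¬single fx in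
  anyFin⁺ x′ (from T-∧ (fx′ , from T-neq λ πx′≡w →
    x′≢x (Injection.injective (↔⇒↣ π) (trans πx′≡w (sym πx≡w)))))

side-bipartition : ∀ {V} (G : Graph V) (side : Fin V → Bool) →
  (∀ u v → G u v ≡ true → side v ≡ not (side u)) →
  IsBipartition G (tabulate side) (∁ (tabulate side))
side-bipartition G side crosses = refl , edge
  where
  edge : ∀ u v → G u v ≡ true →
    (u ∈ tabulate side × v ∈ ∁ (tabulate side)) ⊎ (u ∈ ∁ (tabulate side) × v ∈ tabulate side)
  edge u v Guv with side u in su | crosses u v Guv
  ... | true  | sv = inj₁ ( from ∈-tabulate (subst T (sym su) _)
                          , x∉p⇒x∈∁p (λ v∈ → subst T sv (to ∈-tabulate v∈)))
  ... | false | sv = inj₂ ( x∉p⇒x∈∁p (λ u∈ → subst T su (to ∈-tabulate u∈))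
                          , from ∈-tabulate (subst T (sym sv) _))

N-⊆ : ∀ {V} {G : Graph V} {X Y S : Subset V} → IsBipartition G X Y → S ⊆ X → N G S ⊆ Y
N-⊆ {G = G} {X} {Y} {S} (Y≡∁X , edge) S⊆X {v} v∈NS
  with anyFin⁻ (λ u → lookup S u ∧ G u v) (to ∈-tabulate v∈NS)
... | u , Su∧Guv with to T-∧ Su∧Guv
... | Su , Guv with edge u v (to T-≡ Guv)
... | inj₁ (_ , v∈Y) = v∈Y
... | inj₂ (u∈Y , _) = contradiction (subst (u ∈_) Y≡∁X u∈Y) (x∈p⇒x∉∁p (S⊆X (from ∈⇔T-lookup Su)))

pattern A = zero
pattern B = suc zero
pattern C = suc (suc zero)
pattern D = suc (suc (suc zero))

module Vertices (n : ℕ) where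

  vertex : Fin 4 → Fin n → Fin (4 * n)
  vertex = combine

  onX : Fin 4 → Bool
  onX A = true
  onX B = false
  onX C = true
  onX D = false

  X : Subset (4 * n)
  X = tabulate (onX ∘ quotient n)

  lookup-X : ∀ k x → lookup X (vertex k x) ≡ onX k
  lookup-X k x = trans (lookup∘tabulate _ (vertex k x)) (cong (onX ∘ proj₁) (remQuot-combine k x))

  ⊆X⇒onX : {S : Subset (4 * n)} → S ⊆ X → ∀ {k x} → T (lookup S (vertex k x)) → T (onX k)
  ⊆X⇒onX S⊆X {k} {x} h = subst T (lookup-X k x) (to ∈⇔T-lookup (S⊆X (from ∈⇔T-lookup h)))

  onX⇒⊆X : {S : Subset (4 * n)} → (∀ {k x} → T (lookup S (vertex k x)) → T (onX k)) → S ⊆ X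
  onX⇒⊆X {S} h {v} = combine-ind {P = λ v → v ∈ S → v ∈ X}
    (λ k x Skx → from ∈⇔T-lookup (subst T (sym (lookup-X k x)) (h (to ∈⇔T-lookup Skx)))) v

  adjLab-crosses : (π : Permutation′ n) (k l : Fin 4) {x y : Fin n} →
    adjLab π (k , x) (l , y) ≡ true → onX l ≡ not (onX k)
  adjLab-crosses π A A ()
  adjLab-crosses π A B _ = refl
  adjLab-crosses π A C ()
  adjLab-crosses π A D _ = refl
  adjLab-crosses π B A _ = refl
  adjLab-crosses π B B ()
  adjLab-crosses π B C _ = refl
  adjLab-crosses π B D ()
  adjLab-crosses π C A ()
  adjLab-crosses π C B _ = refl
  adjLab-crosses π C C ()
  adjLab-crosses π C D _ = refl
  adjLab-crosses π D A _ = refl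
  adjLab-crosses π D B ()
  adjLab-crosses π D C _ = refl
  adjLab-crosses π D D ()

  X-bipartition : (π : Permutation′ n) → IsBipartition (Gminus n π) X (∁ X)
  X-bipartition π = side-bipartition (Gminus n π) (onX ∘ quotient n)
    (λ u v → adjLab-crosses π (quotient n u) (quotient n v))

  swapSides : Permutation′ 4
  swapSides = Perm.swap (transpose zero (suc zero))

  ∣X∣≡∣∁X∣ : ∣ X ∣ ≡ ∣ ∁ X ∣
  ∣X∣≡∣∁X∣ = ∣∣-blockwise swapSides (λ _ → Perm.id) {X} {∁ X} λ k x →
    trans (lookup-X (swapSides ⟨$⟩ʳ k) x)
          (trans (onX-swapSides k) (sym (trans (lookup-map (vertex k x) not X) (cong not (lookup-X k x)))))
    where
    onX-swapSides : ∀ k → onX (swapSides ⟨$⟩ʳ k) ≡ not (onX k)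
    onX-swapSides A = refl
    onX-swapSides B = refl
    onX-swapSides C = refl
    onX-swapSides D = refl

  module _ (π : Permutation′ n) (S : Subset (4 * n)) where

    neighbourIn : Fin 4 → Fin 4 → Fin n → Bool
    neighbourIn k l y = anyFin (λ x → lookup S (vertex k x) ∧ adjLab π (k , x) (l , y))

    N-vertex : ∀ l y → lookup (N (Gminus n π) S) (vertex l y) ≡ anyFin (λ k → neighbourIn k l y)
    N-vertex l y = trans (lookup∘tabulate _ (vertex l y)) (trans (anyFin-combine {4} {n} _)
      (anyFin-cong λ k → anyFin-cong λ x → cong (lookup S (vertex k x) ∧_)
        (cong₂ (adjLab π) (remQuot-combine k x) (remQuot-combine l y))))

    -- The left-hand side is anyFin over the four layers, unfolded at a B- or D-vertex.
    drop-Y-layers : ∀ a c →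
      a ∨ (anyFin (λ x → lookup S (vertex B x) ∧ false) ∨
          (c ∨ (anyFin (λ x → lookup S (vertex D x) ∧ false) ∨ false)))
      ≡ a ∨ c
    drop-Y-layers a c = trans
      (cong₂ (λ b d → a ∨ (b ∨ (c ∨ (d ∨ false))))
        (anyFin-∧-false (λ x → lookup S (vertex B x))) (anyFin-∧-false (λ x → lookup S (vertex D x))))
      (cong (a ∨_) (∨-identityʳ c))

    N-Y : ∀ l → onX l ≡ false → ∀ y →
      lookup (N (Gminus n π) S) (vertex l y) ≡ neighbourIn A l y ∨ neighbourIn C l y
    N-Y B _ y = trans (N-vertex B y) (drop-Y-layers (neighbourIn A B y) (neighbourIn C B y))
    N-Y D _ y = trans (N-vertex D y) (drop-Y-layers (neighbourIn A D y) (neighbourIn C D y))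

    N-B : ∀ y → lookup (N (Gminus n π) S) (vertex B y) ≡
      anyFin (λ x → lookup S (vertex A x) ∧ neq x y) ∨ lookup S (vertex C y)
    N-B y = trans (N-Y B refl y) (cong (neighbourIn A B y ∨_) (anyFin-∧-eqb (λ x → lookup S (vertex C x)) y))

    N-D : ∀ y → lookup (N (Gminus n π) S) (vertex D y) ≡
      anyFin (λ x → lookup S (vertex A x) ∧ eqb (π ⟨$⟩ʳ x) y) ∨ anyFin (λ x → lookup S (vertex C x) ∧ neq x y)
    N-D = N-Y D refl

    N-X : S ⊆ X → ∀ k → onX k ≡ true → ∀ y → lookup (N (Gminus n π) S) (vertex k y) ≡ false
    N-X S⊆X k onXk y = T-injective (mk⇔
      (λ h → x∈∁p⇒x∉p (N-⊆ (X-bipartition π) S⊆X (from ∈⇔T-lookup h))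
                      (from ∈⇔T-lookup (subst T (sym (trans (lookup-X k y) onXk)) _)))
      (λ ()))

module Construction (n : ℕ) (π₁ π₂ Λ : Permutation′ n)
  (Λ-fixed : ∀ j → π₁ ⟨$⟩ʳ j ≡ j ⇔ π₂ ⟨$⟩ʳ (Λ ⟨$⟩ʳ j) ≡ Λ ⟨$⟩ʳ j) where

  open Vertices n

  -- _∘ₚ_ composes left to right: ψ r ⟨$⟩ʳ y = π₂ (r (π₁⁻¹ y)).
  ψ : Permutation′ n → Permutation′ n
  ψ r = flip π₁ ∘ₚ r ∘ₚ π₂

  eqb-ψ : ∀ r x y → eqb (π₂ ⟨$⟩ʳ (r ⟨$⟩ʳ x)) (ψ r ⟨$⟩ʳ y) ≡ eqb (π₁ ⟨$⟩ʳ x) y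
  eqb-ψ r x y = trans (cong (λ z → eqb (π₂ ⟨$⟩ʳ (r ⟨$⟩ʳ z)) (ψ r ⟨$⟩ʳ y)) (sym (inverseˡ π₁)))
                      (eqb-permute (ψ r) (π₁ ⟨$⟩ʳ x) y)

  ρ-pair : ∀ j → ∃ λ ρ → ρ ⟨$⟩ʳ j ≡ Λ ⟨$⟩ʳ j × ρ ⟨$⟩ʳ (π₁ ⟨$⟩ˡ j) ≡ π₂ ⟨$⟩ˡ (Λ ⟨$⟩ʳ j)
  ρ-pair j = pair-permutation _ _ _ _ (fixed-flip π₂ ⇔-∘ (Λ-fixed j ⇔-∘ ⇔-sym (fixed-flip π₁)))

  ρ : Fin n → Permutation′ n
  ρ j = proj₁ (ρ-pair j)

  ρ-at : ∀ j → ρ j ⟨$⟩ʳ j ≡ Λ ⟨$⟩ʳ j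
  ρ-at j = proj₁ (proj₂ (ρ-pair j))

  ψρ-at : ∀ j → ψ (ρ j) ⟨$⟩ʳ j ≡ Λ ⟨$⟩ʳ j
  ψρ-at j = trans (cong (π₂ ⟨$⟩ʳ_) (proj₂ (proj₂ (ρ-pair j)))) (inverseʳ π₂)

  companion : Subset n → Permutation′ n
  companion J with singleton? J
  ... | yes (j , _) = ρ j
  ... | no  _       = Λ

  companion-C : (f : Fin n → Bool) (y : Fin n) → f (Λ ⟨$⟩ˡ (companion (tabulate f) ⟨$⟩ʳ y)) ≡ f y
  companion-C f y with singleton? (tabulate f)
  ... | no  _ = cong f (inverseˡ Λ)
  ... | yes (j , f≡⁅j⁆) = begin
    f (Λ ⟨$⟩ˡ (ρ j ⟨$⟩ʳ y))                          ≡⟨ singleton-eqb f≡⁅j⁆ _ ⟩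
    eqb j (Λ ⟨$⟩ˡ (ρ j ⟨$⟩ʳ y))                      ≡⟨ cong (λ z → eqb z (Λ ⟨$⟩ˡ (ρ j ⟨$⟩ʳ y))) j≡ ⟩
    eqb (Λ ⟨$⟩ˡ (ρ j ⟨$⟩ʳ j)) (Λ ⟨$⟩ˡ (ρ j ⟨$⟩ʳ y))  ≡⟨ eqb-permute (ρ j ∘ₚ flip Λ) j y ⟩
    eqb j y                                          ≡⟨ singleton-eqb f≡⁅j⁆ y ⟨
    f y                                              ∎
    where
    open ≡-Reasoning
    j≡ : j ≡ Λ ⟨$⟩ˡ (ρ j ⟨$⟩ʳ j)
    j≡ = sym (trans (cong (Λ ⟨$⟩ˡ_) (ρ-at j)) (inverseˡ Λ))

  companion-D : (f : Fin n → Bool) (y : Fin n) →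
    anyFin (λ x → f x ∧ neq (Λ ⟨$⟩ʳ x) (ψ (companion (tabulate f)) ⟨$⟩ʳ y)) ≡ anyFin (λ x → f x ∧ neq x y)
  companion-D f y with singleton? (tabulate f)
  ... | no ¬single = T-injective (mk⇔
    (λ h → nonSingleton-avoids ¬single Perm.id y (member (λ x → neq (Λ ⟨$⟩ʳ x) (ψ Λ ⟨$⟩ʳ y)) h))
    (λ h → nonSingleton-avoids ¬single Λ (ψ Λ ⟨$⟩ʳ y) (member (λ x → neq x y) h)))
    where
    member : ∀ g → T (anyFin (λ x → f x ∧ g x)) → ∃ (T ∘ f)
    member g h = let (x , fx∧gx) = anyFin⁻ (λ x → f x ∧ g x) h in x , proj₁ (to T-∧ fx∧gx)
  ... | yes (j , f≡⁅j⁆) = begin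
    anyFin (λ x → f x ∧ neq (Λ ⟨$⟩ʳ x) (ψ (ρ j) ⟨$⟩ʳ y)) ≡⟨ anyFin-singleton f≡⁅j⁆ _ ⟩
    neq (Λ ⟨$⟩ʳ j) (ψ (ρ j) ⟨$⟩ʳ y)                       ≡⟨ cong (λ z → neq z (ψ (ρ j) ⟨$⟩ʳ y)) (ψρ-at j) ⟨
    neq (ψ (ρ j) ⟨$⟩ʳ j) (ψ (ρ j) ⟨$⟩ʳ y)                 ≡⟨ cong not (eqb-permute (ψ (ρ j)) j y) ⟩
    neq j y                                               ≡⟨ anyFin-singleton f≡⁅j⁆ _ ⟨
    anyFin (λ x → f x ∧ neq x y)                          ∎
    where open ≡-Reasoning

  xLayers : Permutation′ n → Fin 4 → Permutation′ n
  xLayers r A = r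
  xLayers r C = Λ
  xLayers r _ = Perm.id

  yLayers : Permutation′ n → Fin 4 → Permutation′ n
  yLayers r B = r
  yLayers r D = ψ r
  yLayers r _ = Perm.id

  C-part : Subset (4 * n) → Subset n
  C-part S = tabulate (λ x → lookup S (vertex C x))

  relabelling : Subset n → Permutation′ (4 * n)
  relabelling J = fibrewise (xLayers (companion J))

  η : Subset (4 * n) → Subset (4 * n)
  η S = relabel (relabelling (C-part S)) S

  module _ (S : Subset (4 * n)) where

    private
      r : Permutation′ n
      r = companion (C-part S)
      s : Fin 4 → Fin n → Bool
      s k x = lookup S (vertex k x)

    ∣η∣ : ∣ η S ∣ ≡ ∣ S ∣
    ∣η∣ = ∣relabel∣ (relabelling (C-part S)) S

    η-vertex : ∀ k x → lookup (η S) (vertex k x) ≡ s k (xLayers r k ⟨$⟩ˡ x)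
    η-vertex = lookup-relabel-fibrewise (xLayers r) S

    η-C : ∀ x → lookup (η S) (vertex C (Λ ⟨$⟩ʳ x)) ≡ s C x
    η-C x = trans (η-vertex C _) (cong (s C) (inverseˡ Λ))

    η-⊆X : S ⊆ X → η S ⊆ X
    η-⊆X S⊆X = onX⇒⊆X λ {k} {x} h → ⊆X⇒onX S⊆X (subst T (η-vertex k x) h)

    N-η-B : ∀ y → lookup (N (Gminus n π₂) (η S)) (vertex B (r ⟨$⟩ʳ y))
                ≡ lookup (N (Gminus n π₁) S) (vertex B y)
    N-η-B y = begin
      lookup (N (Gminus n π₂) (η S)) (vertex B (r ⟨$⟩ʳ y))
        ≡⟨ N-B π₂ (η S) (r ⟨$⟩ʳ y) ⟩
      anyFin (λ x → lookup (η S) (vertex A x) ∧ neq x (r ⟨$⟩ʳ y)) ∨ lookup (η S) (vertex C (r ⟨$⟩ʳ y))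
        ≡⟨ cong₂ _∨_ (anyFin-cong λ x → cong (_∧ neq x (r ⟨$⟩ʳ y)) (η-vertex A x)) (η-vertex C (r ⟨$⟩ʳ y)) ⟩
      anyFin (λ x → s A (r ⟨$⟩ˡ x) ∧ neq x (r ⟨$⟩ʳ y)) ∨ s C (Λ ⟨$⟩ˡ (r ⟨$⟩ʳ y))
        ≡⟨ cong₂ _∨_ (anyFin-relabel r (s A) (λ x → neq x (r ⟨$⟩ʳ y))) (companion-C (s C) y) ⟩
      anyFin (λ x → s A x ∧ neq (r ⟨$⟩ʳ x) (r ⟨$⟩ʳ y)) ∨ s C y
        ≡⟨ cong (_∨ s C y) (anyFin-cong λ x → cong (λ b → s A x ∧ not b) (eqb-permute r x y)) ⟩
      anyFin (λ x → s A x ∧ neq x y) ∨ s C y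
        ≡⟨ N-B π₁ S y ⟨
      lookup (N (Gminus n π₁) S) (vertex B y) ∎
      where open ≡-Reasoning

    N-η-D : ∀ y → lookup (N (Gminus n π₂) (η S)) (vertex D (ψ r ⟨$⟩ʳ y))
                ≡ lookup (N (Gminus n π₁) S) (vertex D y)
    N-η-D y = begin
      lookup (N (Gminus n π₂) (η S)) (vertex D (ψ r ⟨$⟩ʳ y))
        ≡⟨ N-D π₂ (η S) (ψ r ⟨$⟩ʳ y) ⟩
      anyFin (λ x → lookup (η S) (vertex A x) ∧ eqb (π₂ ⟨$⟩ʳ x) (ψ r ⟨$⟩ʳ y)) ∨
      anyFin (λ x → lookup (η S) (vertex C x) ∧ neq x (ψ r ⟨$⟩ʳ y))
        ≡⟨ cong₂ _∨_ (anyFin-cong λ x → cong (_∧ eqb (π₂ ⟨$⟩ʳ x) (ψ r ⟨$⟩ʳ y)) (η-vertex A x))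
                     (anyFin-cong λ x → cong (_∧ neq x (ψ r ⟨$⟩ʳ y)) (η-vertex C x)) ⟩
      anyFin (λ x → s A (r ⟨$⟩ˡ x) ∧ eqb (π₂ ⟨$⟩ʳ x) (ψ r ⟨$⟩ʳ y)) ∨
      anyFin (λ x → s C (Λ ⟨$⟩ˡ x) ∧ neq x (ψ r ⟨$⟩ʳ y))
        ≡⟨ cong₂ _∨_ (anyFin-relabel r (s A) (λ x → eqb (π₂ ⟨$⟩ʳ x) (ψ r ⟨$⟩ʳ y)))
                     (anyFin-relabel Λ (s C) (λ x → neq x (ψ r ⟨$⟩ʳ y))) ⟩
      anyFin (λ x → s A x ∧ eqb (π₂ ⟨$⟩ʳ (r ⟨$⟩ʳ x)) (ψ r ⟨$⟩ʳ y)) ∨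
      anyFin (λ x → s C x ∧ neq (Λ ⟨$⟩ʳ x) (ψ r ⟨$⟩ʳ y))
        ≡⟨ cong₂ _∨_ (anyFin-cong λ x → cong (s A x ∧_) (eqb-ψ r x y)) (companion-D (s C) y) ⟩
      anyFin (λ x → s A x ∧ eqb (π₁ ⟨$⟩ʳ x) y) ∨ anyFin (λ x → s C x ∧ neq x y)
        ≡⟨ N-D π₁ S y ⟨
      lookup (N (Gminus n π₁) S) (vertex D y) ∎
      where open ≡-Reasoning

    ∣N-η∣ : S ⊆ X → ∣ N (Gminus n π₂) (η S) ∣ ≡ ∣ N (Gminus n π₁) S ∣
    ∣N-η∣ S⊆X = ∣∣-blockwise Perm.id (yLayers r) {N (Gminus n π₂) (η S)} {N (Gminus n π₁) S} N-η
      where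
      N-η : ∀ k y → lookup (N (Gminus n π₂) (η S)) (vertex k (yLayers r k ⟨$⟩ʳ y))
                  ≡ lookup (N (Gminus n π₁) S) (vertex k y)
      N-η A y = trans (N-X π₂ (η S) (η-⊆X S⊆X) A refl y) (sym (N-X π₁ S S⊆X A refl y))
      N-η B y = N-η-B y
      N-η C y = trans (N-X π₂ (η S) (η-⊆X S⊆X) C refl y) (sym (N-X π₁ S S⊆X C refl y))
      N-η D y = N-η-D y

  η-injective : ∀ S S′ → η S ≡ η S′ → S ≡ S′
  η-injective S S′ ηS≡ηS′ = begin
    S                                                ≡⟨ relabel-flip (relabelling (C-part S)) S ⟨
    relabel (flip (relabelling (C-part S))) (η S)    ≡⟨ cong₂ (relabel ∘ flip ∘ relabelling) C-part≡ ηS≡ηS′ ⟩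
    relabel (flip (relabelling (C-part S′))) (η S′)  ≡⟨ relabel-flip (relabelling (C-part S′)) S′ ⟩
    S′                                               ∎
    where
    open ≡-Reasoning
    C-part≡ : C-part S ≡ C-part S′
    C-part≡ = tabulate-cong λ x →
      trans (sym (η-C S x)) (trans (cong (λ U → lookup U (vertex C (Λ ⟨$⟩ʳ x))) ηS≡ηS′) (η-C S′ x))

  η-surjective : ∀ U → U ⊆ X → ∃ λ S → S ⊆ X × η S ≡ U
  η-surjective U U⊆X = S , S⊆X , ηS≡U
    where
    J : Subset n
    J = tabulate (λ x → lookup U (vertex C (Λ ⟨$⟩ʳ x)))
    S : Subset (4 * n)
    S = relabel (flip (relabelling J)) U
    S-vertex : ∀ k x → lookup S (vertex k x) ≡ lookup U (vertex k (xLayers (companion J) k ⟨$⟩ʳ x))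
    S-vertex = lookup-relabel-fibrewise⁻¹ (xLayers (companion J)) U
    S⊆X : S ⊆ X
    S⊆X = onX⇒⊆X λ {k} {x} h → ⊆X⇒onX U⊆X (subst T (S-vertex k x) h)
    ηS≡U : η S ≡ U
    ηS≡U = trans (cong (λ J′ → relabel (relabelling J′) S) (tabulate-cong (S-vertex C)))
                 (relabel-flip (flip (relabelling J)) U)

lemma15 : ∀ (n : ℕ) → 3 ≤ n → (π₁ π₂ : Permutation′ n) →
    fixCount π₁ ≡ fixCount π₂ → NSEquiv (Gminus n π₁) (Gminus n π₂)
-- The construction works for every n.
lemma15 n _ π₁ π₂ sameFixCount =
  X , ∁ X , X , ∁ X , X-bipartition π₁ , X-bipartition π₂ ,
  ≤-reflexive ∣X∣≡∣∁X∣ , ≤-reflexive ∣X∣≡∣∁X∣ , refl , refl ,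
  η , η-⊆X , (λ S S′ _ _ → η-injective S S′) , η-surjective ,
  λ S S⊆X → ∣η∣ S , ∣N-η∣ S S⊆X
  where
  aligned : ∃ λ (Λ : Permutation′ n) → ∀ j → eqb (π₂ ⟨$⟩ʳ (Λ ⟨$⟩ʳ j)) (Λ ⟨$⟩ʳ j) ≡ eqb (π₁ ⟨$⟩ʳ j) j
  aligned = align (λ j → eqb (π₁ ⟨$⟩ʳ j) j) (λ j → eqb (π₂ ⟨$⟩ʳ j) j) sameFixCount
  open Vertices n
  open Construction n π₁ π₂ (proj₁ aligned) (λ j → eqb-≡⇒⇔ (sym (proj₂ aligned j)))
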